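{- Let $(H,u_1u_2u_3)$ be a lucky tracker of a graph $G$ and let $S$ be a full star-cutset of $H$. Then at least one of the following holds: (B1) for each $u_1u_2u_3$-hole $C$ of $H$, there is a connected component $B$ of $H\setminus S$ such that $C$ is a subgraph of $H[V(B)\cup S]$; (B2) there are two non-adjacent nodes $s_1,s_2\in S$ and two distinct connected components $B_1,B_2$ of $H\setminus S$ such that each of $s_1,s_2$ has a neighbour in $B_1$ and a neighbour in $B_2$.
   Context: All graphs are finite, simple, undirected; $N_H[s]$ is the closed neighbourhood of $s$. A hole is an induced simple cycle with at least four nodes; it is even if it has an even number of nodes; a shortest even hole is one with the minimum number of nodes. A $k$-path is a path with $k$ nodes. For a hole $C$ of $H$ and $x\notin V(C)$, $N_C(x)=N_H(x)\cap V(C)$; $x$ is a major node of $C$ if $N_C(x)$ contains three pairwise non-adjacent nodes, and $M_H(C)$ is the set of major nodes. $N_H^{2,2}(C)$ is the set of non-major nodes $x$ adjacent to $C$ such that $C[N_C(x)]$ has exactly two connected components, each with two nodes. $C$ is clean if $M_H(C)=N_H^{2,2}(C)=\varnothing$. A $u_1u_2u_3$-hole of $H$ is a clean shortest even hole $C$ of $H$ such that $u_1u_2u_3$ is a $3$-path of $C$. A tracker of $G$ is a pair $(H,u_1u_2u_3)$ with $H$ an induced subgraph of $G$ and $u_1u_2u_3$ a $3$-path of $H$; it is lucky if $H$ has a $u_1u_2u_3$-hole. A star-cutset of $H$ is a set $S\subseteq V(H)$ with $S\subseteq N_H[s]$ for some $s\in S$ such that $H\setminus S$ has more connected components than $H$;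 it is full if $S=N_H[s]$ for some $s\in S$. -}

module Defs where

open import Data.Nat using (ℕ; zero; suc; _≤_; _<_)
open import Data.Nat.Divisibility using (_∣_)
open import Data.Fin using (Fin; toℕ)
open import Data.Fin.Subset using (Subset; _∈_; _∉_)
open import Data.Bool using (Bool; true; false)
open import Data.Product using (Σ; ∃; ∃-syntax; _×_; _,_)
open import Data.Sum using (_⊎_)
open import Relation.Nullary using (¬_)
open import Relation.Binary.PropositionalEquality using (_≡_; _≢_)
open import Function.Definitions using (Injective)

record Graph (n : ℕ) : Set where
  field
    adj    : Fin n → Fin n → Bool
    sym    : ∀ u v → adj u v ≡ adj v u
    irrefl : ∀ v → adj v v ≡ false

open Graph public

VSet : ℕ → Set₁
VSet n = Fin n → Set

module _ {n : ℕ} (G : Graph n) where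

  -- edge relation of G; since all subgraphs considered are induced,
  -- this is also the edge relation of every induced subgraph
  E : Fin n → Fin n → Set
  E u v = adj G u v ≡ true

  data Walk (Y : VSet n) : Fin n → Fin n → Set where
    here : ∀ {u} → Y u → Walk Y u u
    step : ∀ {u w v} → Y u → E u w → Walk Y w v → Walk Y u v

  -- Y has exactly k connected components: there are k representatives,
  -- pairwise in different components, such that every node of Y lies in
  -- the component of one of them
  NumComp : VSet n → ℕ → Set
  NumComp Y k =
    Σ (Fin k → Fin n) λ r →
      (∀ i → Y (r i)) ×
      (∀ i j → Walk Y (r i) (r j) → i ≡ j) ×
      (∀ v → Y v → ∃ λ i → Walk Y (r i) v)

  ⟦_⟧ : Subset n → VSet n
  ⟦ H ⟧ v = v ∈ H

  _∖_ : Subset n → Subset n → VSet n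
  (H ∖ S) v = v ∈ H × v ∉ S

  HasExactlyTwo : VSet n → Set
  HasExactlyTwo P = ∃ λ p → ∃ λ q → p ≢ q × P p × P q ×
                     (∀ r → P r → r ≡ p ⊎ r ≡ q)

  CycAdj : (k : ℕ) → Fin k → Fin k → Set
  CycAdj k i j =
    suc (toℕ i) ≡ toℕ j ⊎ suc (toℕ j) ≡ toℕ i ⊎
    (toℕ i ≡ 0 × suc (toℕ j) ≡ k) ⊎ (toℕ j ≡ 0 × suc (toℕ i) ≡ k)

  -- a hole of H (= H[subset]): an induced cycle with ≥ 4 nodes,
  -- given by a cyclic enumeration of its distinct nodes
  record Hole (H : Subset n) : Set where
    field
      len    : ℕ
      len≥4  : 4 ≤ len
      node   : Fin len → Fin n
      inj    : Injective _≡_ _≡_ node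
      inH    : ∀ i → node i ∈ H
      induced : ∀ i j → (E (node i) (node j) → CycAdj len i j)
                      × (CycAdj len i j → E (node i) (node j))

  open Hole public

  V : {H : Subset n} → Hole H → VSet n
  V C v = ∃ λ i → node C i ≡ v

  EvenHole : Subset n → Set
  EvenHole H = Σ (Hole H) λ C → 2 ∣ len C

  ShortestEvenHole : (H : Subset n) → Hole H → Set
  ShortestEvenHole H C = 2 ∣ len C × (∀ (C' : Hole H) → 2 ∣ len C' → len C ≤ len C')

  N_C : {H : Subset n} → Hole H → Fin n → VSet n
  N_C C x v = V C v × E x v

  Major : (H : Subset n) → Hole H → Fin n → Set
  Major H C x = x ∈ H × ¬ V C x ×
    ∃ λ a → ∃ λ b → ∃ λ c →
      N_C C x a × N_C C x b × N_C C x c ×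
      a ≢ b × b ≢ c × a ≢ c ×
      ¬ E a b × ¬ E b c × ¬ E a c

  -- membership in N^{2,2}_H(C): C[N_C(x)] has exactly two components,
  -- each with exactly two nodes
  N22 : (H : Subset n) → Hole H → Fin n → Set
  N22 H C x = x ∈ H × ¬ V C x × ¬ Major H C x × (∃ λ v → N_C C x v) ×
    ∃ λ a → ∃ λ c →
      N_C C x a × N_C C x c × ¬ Walk (N_C C x) a c ×
      (∀ y → N_C C x y → Walk (N_C C x) a y ⊎ Walk (N_C C x) c y) ×
      HasExactlyTwo (Walk (N_C C x) a) × HasExactlyTwo (Walk (N_C C x) c)

  Clean : (H : Subset n) → Hole H → Set
  Clean H C = ∀ x → ¬ Major H C x × ¬ N22 H C x

  ThreePath : VSet n → Fin n → Fin n → Fin n → Set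
  ThreePath X u₁ u₂ u₃ = X u₁ × X u₂ × X u₃ ×
    u₁ ≢ u₂ × u₂ ≢ u₃ × u₁ ≢ u₃ × E u₁ u₂ × E u₂ u₃

  U-Hole : (H : Subset n) → Fin n → Fin n → Fin n → Hole H → Set
  U-Hole H u₁ u₂ u₃ C = Clean H C × ShortestEvenHole H C × ThreePath (V C) u₁ u₂ u₃

  -- tracker (H, u1u2u3) of G (H is an induced subgraph of G, given by its
  -- node set) and luckiness
  Tracker : Subset n → Fin n → Fin n → Fin n → Set
  Tracker H u₁ u₂ u₃ = ThreePath ⟦ H ⟧ u₁ u₂ u₃

  Lucky : Subset n → Fin n → Fin n → Fin n → Set
  Lucky H u₁ u₂ u₃ = Tracker H u₁ u₂ u₃ × ∃ λ (C : Hole H) → U-Hole H u₁ u₂ u₃ C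

  StarCutset : Subset n → Subset n → Set
  StarCutset H S =
    (∀ v → v ∈ S → v ∈ H) ×
    (∃ λ s → s ∈ S × (∀ v → v ∈ S → v ≡ s ⊎ E s v)) ×
    (∃ λ k → ∃ λ k' → NumComp ⟦ H ⟧ k × NumComp (H ∖ S) k' × k < k')

  FullStarCutset : Subset n → Subset n → Set
  FullStarCutset H S = StarCutset H S ×
    ∃ λ s → s ∈ S × (∀ v → v ∈ S → v ∈ H × (v ≡ s ⊎ E s v))
                  × (∀ v → v ∈ H → (v ≡ s ⊎ E s v) → v ∈ S)

  B1 : (H S : Subset n) → Fin n → Fin n → Fin n → Set
  B1 H S u₁ u₂ u₃ = ∀ (C : Hole H) → U-Hole H u₁ u₂ u₃ C →
    ∃ λ b → (H ∖ S) b × (∀ v → V C v → Walk (H ∖ S) b v ⊎ v ∈ S)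

  -- (B2); components of H \ S represented by representatives b₁, b₂
  B2 : (H S : Subset n) → Set
  B2 H S = ∃ λ s₁ → ∃ λ s₂ → s₁ ∈ S × s₂ ∈ S × s₁ ≢ s₂ × ¬ E s₁ s₂ ×
    ∃ λ b₁ → ∃ λ b₂ → (H ∖ S) b₁ × (H ∖ S) b₂ × ¬ Walk (H ∖ S) b₁ b₂ ×
      (∃ λ x → Walk (H ∖ S) b₁ x × E s₁ x) × (∃ λ x → Walk (H ∖ S) b₂ x × E s₁ x) ×
      (∃ λ x → Walk (H ∖ S) b₁ x × E s₂ x) × (∃ λ x → Walk (H ∖ S) b₂ x × E s₂ x)

module Submission where

open import Defs hiding (sym)
open import Data.Nat using (ℕ; zero; suc; _+_; _*_; _∸_; _≤_; _<_; z≤n; s≤s; NonZero; _%_; _/_; _≤?_)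
open import Data.Nat.Properties
open import Data.Nat.DivMod using (m≡m%n+[m/n]*n; m%n<n; [m+kn]%n≡m%n; m<n⇒m%n≡m; n%n≡0)
open import Data.Nat.Divisibility using (_∣_; divides; ∣m∣n⇒∣m+n; ∣m+n∣m⇒∣n; ∣-refl)
open import Data.Nat.Tactic.RingSolver using (solve-∀)
open import Data.Bool using (true) renaming (_≟_ to _≟B_)
open import Data.Sum using (_⊎_; inj₁; inj₂) renaming (map to ⊎-map)
open import Data.Product using (Σ; ∃; _×_; _,_; proj₁; proj₂)
open import Data.Empty using (⊥; ⊥-elim)
open import Data.Fin using (Fin; toℕ; fromℕ<) renaming (zero to fzero; suc to fsuc)
open import Data.Fin.Properties using (toℕ-fromℕ<; toℕ-injective; toℕ<n; any?) renaming (_≟_ to _≟F_)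
open import Data.Fin.Subset using (Subset; _∈_)
open import Data.Fin.Subset.Properties using (_∈?_)
open import Relation.Nullary using (¬_; Dec; yes; no)
open import Relation.Nullary.Decidable using (_×-dec_; ¬?; decidable-stable)
open import Relation.Binary.PropositionalEquality using (_≡_; _≢_; refl; sym; trans; cong; subst)

-- Label every node by the component of H ∖ S containing it, and by 0 if it
-- lies in S.  Condition (B2) speaks about finitely many nodes, so it is
-- decidable; when it fails we show that every clean shortest even hole C
-- lies in S ∪ B for a single component B.
-- Enumerating C periodically by ℕ, adjacent nodes outside S share their
-- label, so C ∖ S splits into arcs, each inside one component.  If s ∈ C,
-- then C ∖ N[s] is a single arc.  If s ∉ C and two arcs carry different
-- labels, rotate C so that two consecutive label changes bound arcs
-- 0 … x and y … X separated by two gaps of neighbours of s.  As s is not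
-- major, each gap has one or two nodes: two single gaps give (B2); a single
-- and a double gap give two holes through s of total length |C| + 3, one
-- of them even and shorter than C; two double gaps put s in N²²(C).

-- a ≡[ L ] b : a and b differ by a multiple of L.  Stating congruence
-- this way (rather than through _%_) keeps the enumeration of a hole by
-- natural numbers free of division.
infix 4 _≡[_]_
_≡[_]_ : ℕ → ℕ → ℕ → Set
a ≡[ L ] b = ∃ λ k → a + k * L ≡ b ⊎ b + k * L ≡ a

≡[]-cancelˡ : ∀ {L} r a b → r + a ≡[ L ] r + b → a ≡[ L ] b
≡[]-cancelˡ {L} r a b (k , inj₁ e) = k , inj₁ (+-cancelˡ-≡ r _ _ (trans (sym (+-assoc r a (k * L))) e))
≡[]-cancelˡ {L} r a b (k , inj₂ e) = k , inj₂ (+-cancelˡ-≡ r _ _ (trans (sym (+-assoc r b (k * L))) e))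

≡[]-+ˡ : ∀ {L} r a b → a ≡[ L ] b → r + a ≡[ L ] r + b
≡[]-+ˡ {L} r a b (k , inj₁ e) = k , inj₁ (trans (+-assoc r a (k * L)) (cong (r +_) e))
≡[]-+ˡ {L} r a b (k , inj₂ e) = k , inj₂ (trans (+-assoc r b (k * L)) (cong (r +_) e))

≡[]-period : ∀ {L} a → L + a ≡[ L ] a
≡[]-period {L} a = 1 , inj₂ (trans (cong (a +_) (+-identityʳ L)) (+-comm a L))

+-multiples : ∀ {L} r q o → r + q * L + o * L ≡ r + (q + o) * L
+-multiples {L} r q o = trans (+-assoc r (q * L) (o * L)) (cong (r +_) (sym (*-distribʳ-+ L q o)))

≡[]-remainder : ∀ {L a b} r q₁ q₂ → a ≡ r + q₁ * L → b ≡ r + q₂ * L → a ≡[ L ] b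
≡[]-remainder r q₁ q₂ refl refl with ≤-total q₁ q₂
... | inj₁ q₁≤q₂ with m≤n⇒∃[o]m+o≡n q₁≤q₂
...   | o , refl = o , inj₁ (+-multiples r q₁ o)
≡[]-remainder r q₁ q₂ refl refl | inj₂ q₂≤q₁ with m≤n⇒∃[o]m+o≡n q₂≤q₁
...   | o , refl = o , inj₂ (+-multiples r q₂ o)

L≤+multiple : ∀ {L} b k → L ≤ b + suc k * L
L≤+multiple {L} b k = ≤-trans (m≤m+n L (k * L)) (m≤n+m (L + k * L) b)

≡[]-below⇒≡ : ∀ {L a b} → a < L → b < L → a ≡[ L ] b → a ≡ b
≡[]-below⇒≡ {L} {a} {b} a<L b<L (zero , inj₁ e) = trans (sym (+-identityʳ a)) e
≡[]-below⇒≡ {L} {a} {b} a<L b<L (zero , inj₂ e) = sym (trans (sym (+-identityʳ b)) e)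
≡[]-below⇒≡ {L} {a} {b} a<L b<L (suc k , inj₁ e) = ⊥-elim (<⇒≱ b<L (subst (L ≤_) e (L≤+multiple a k)))
≡[]-below⇒≡ {L} {a} {b} a<L b<L (suc k , inj₂ e) = ⊥-elim (<⇒≱ a<L (subst (L ≤_) e (L≤+multiple b k)))

≡[]-suc-below : ∀ {L a b} → a < L → b < L → suc a ≡[ L ] b → suc a ≡ b ⊎ (suc a ≡ L × b ≡ 0)
≡[]-suc-below {L} {a} {b} a<L b<L (zero , inj₁ e) = inj₁ (trans (sym (+-identityʳ (suc a))) e)
≡[]-suc-below {L} {a} {b} a<L b<L (zero , inj₂ e) = inj₁ (sym (trans (sym (+-identityʳ b)) e))
≡[]-suc-below {L} {a} {b} a<L b<L (suc k , inj₁ e) = ⊥-elim (<⇒≱ b<L (subst (L ≤_) e (L≤+multiple (suc a) k)))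
≡[]-suc-below {L} {a} {zero} a<L b<L (suc zero , inj₂ e) = inj₂ (sym (trans (sym (+-identityʳ L)) e) , refl)
≡[]-suc-below {L} {a} {suc b} a<L b<L (suc zero , inj₂ e) =
  ⊥-elim (<⇒≱ a<L (subst (L ≤_) (suc-injective e) (≤-trans (m≤n+m L b) (≤-reflexive (cong (b +_) (sym (+-identityʳ L)))))))
≡[]-suc-below {L} {a} {b} a<L b<L (suc (suc k) , inj₂ e) =
  ⊥-elim (<⇒≱ 1+a<L+L (subst (L + L ≤_) e (≤-trans (+-monoʳ-≤ L (m≤m+n L (k * L))) (m≤n+m _ b))))
  where
  1+a<L+L : suc a < L + L
  1+a<L+L = ≤-trans (s≤s a<L) (subst (_< L + L) (+-identityʳ L) (+-monoʳ-< L (≤-trans (s≤s z≤n) a<L)))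

module Remainder (L : ℕ) .{{_ : NonZero L}} where

  %-≡⇒≡[] : ∀ c d → c % L ≡ d % L → c ≡[ L ] d
  %-≡⇒≡[] c d e = ≡[]-remainder (c % L) (c / L) (d / L) (m≡m%n+[m/n]*n c L)
                    (trans (m≡m%n+[m/n]*n d L) (cong (_+ (d / L) * L) (sym e)))

  ≡[]⇒%-≡ : ∀ c d → c ≡[ L ] d → c % L ≡ d % L
  ≡[]⇒%-≡ c d (k , inj₁ e) = trans (sym ([m+kn]%n≡m%n c k L)) (cong (_% L) e)
  ≡[]⇒%-≡ c d (k , inj₂ e) = sym (trans (sym ([m+kn]%n≡m%n d k L)) (cong (_% L) e))

  %-suc : ∀ c → suc c % L ≡ suc (c % L) % L
  %-suc c = trans (cong (λ z → suc z % L) (m≡m%n+[m/n]*n c L)) ([m+kn]%n≡m%n (suc (c % L)) (c / L) L)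

  suc-% : ∀ c → (suc c % L ≡ suc (c % L)) ⊎ (suc (c % L) ≡ L × suc c % L ≡ 0)
  suc-% c with m≤n⇒m<n∨m≡n (m%n<n c L)
  ... | inj₁ lt = inj₁ (trans (%-suc c) (m<n⇒m%n≡m lt))
  ... | inj₂ eq = inj₂ (eq , trans (%-suc c) (trans (cong (_% L) eq) (n%n≡0 L)))

  suc-%⇒≡[] : ∀ c d → suc (c % L) ≡ d % L → suc c ≡[ L ] d
  suc-%⇒≡[] c d e = ≡[]-remainder (suc (c % L)) (c / L) (d / L) (cong suc (m≡m%n+[m/n]*n c L))
                      (trans (m≡m%n+[m/n]*n d L) (cong (_+ (d / L) * L) (sym e)))

  wrap-%⇒≡[] : ∀ c d → c % L ≡ 0 → suc (d % L) ≡ L → suc d ≡[ L ] c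
  wrap-%⇒≡[] c d e₁ e₂ = ≡[]-remainder 0 (suc (d / L)) (c / L)
     (trans (cong suc (m≡m%n+[m/n]*n d L)) (cong (_+ (d / L) * L) e₂))
     (trans (m≡m%n+[m/n]*n c L) (cong (_+ (c / L) * L) e₁))

even-or-odd : ∀ a → 2 ∣ a ⊎ 2 ∣ suc a
even-or-odd zero = inj₁ (divides 0 refl)
even-or-odd (suc a) with even-or-odd a
... | inj₁ 2∣a = inj₂ (∣m∣n⇒∣m+n ∣-refl 2∣a)
... | inj₂ 2∣1+a = inj₁ 2∣1+a

-- If a + b = c + 3 with c even, then a or b is even.  This is the
-- parity count behind "one of the two detours around s is even".
one-even : ∀ a b c → a + b ≡ c + 3 → 2 ∣ c → 2 ∣ a ⊎ 2 ∣ b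
one-even a b c a+b≡c+3 2∣c with even-or-odd a
... | inj₁ 2∣a = inj₁ 2∣a
... | inj₂ 2∣1+a = inj₂ (∣m+n∣m⇒∣n 2∣1+a+b 2∣1+a)
  where
  2∣1+a+b : 2 ∣ suc a + b
  2∣1+a+b = subst (2 ∣_) (sym (trans (cong suc a+b≡c+3) (sym (+-suc c 3)))) (∣m∣n⇒∣m+n 2∣c (divides 2 refl))

sum-bound : ∀ {a b M} → a + b ≡ M + 3 → 4 ≤ b → a < M
sum-bound {a} {b} {M} a+b≡M+3 4≤b =
  +-cancelʳ-≤ 3 (suc a) M (≤-trans (≤-reflexive (sym (+-suc a 3))) (≤-trans (+-monoʳ-≤ a 4≤b) (≤-reflexive a+b≡M+3)))

-- Sizes of a gap: for X ≤ m + 2, the stretch X+1 … m+3 has one, two,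
-- or at least three positions.
gap-from-top : ∀ {X m} → X ≤ 2 + m → X ≡ 2 + m ⊎ X ≡ 1 + m ⊎ X ≤ m
gap-from-top X≤2+m with m≤n⇒m<n∨m≡n X≤2+m
... | inj₂ e = inj₁ e
... | inj₁ X<2+m with m≤n⇒m<n∨m≡n (≤-pred X<2+m)
...   | inj₂ e = inj₂ (inj₁ e)
...   | inj₁ X<1+m = inj₂ (inj₂ (≤-pred X<1+m))

-- For x + 2 ≤ y, the stretch x+1 … y-1 has one, two, or at least three
-- positions.
gap-from-bottom : ∀ {x y} → 2 + x ≤ y → y ≡ 2 + x ⊎ y ≡ 3 + x ⊎ 4 + x ≤ y
gap-from-bottom x+2≤y with m≤n⇒m<n∨m≡n x+2≤y
... | inj₂ e = inj₁ (sym e)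
... | inj₁ x+3≤y with m≤n⇒m<n∨m≡n x+3≤y
...   | inj₂ e = inj₂ (inj₁ (sym e))
...   | inj₁ x+4≤y = inj₂ (inj₂ x+4≤y)

one-turn : ∀ c m → c + 1 * (4 + m) ≡ c + 2 + (2 + m)
one-turn = solve-∀

detour-lengths : ∀ x d → (2 + (2 + x)) + (2 + (2 + d)) ≡ 4 + suc (x + d) + 3
detour-lengths = solve-∀

detour-end₂ : ∀ x d → 2 + x + (2 + d) ≡ 3 + suc (x + d)
detour-end₂ = solve-∀

detour-end₁ : ∀ x d → 1 + x + (2 + d) ≡ 2 + suc (x + d)
detour-end₁ = solve-∀

-- rotating by y, where y + w is the hole length
regroup : ∀ y x w → y + (x + w) ≡ (y + w) + x
regroup = solve-∀

regroup-suc : ∀ y x w u → y + (suc (x + w) + u) ≡ (y + w) + (suc x + u)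
regroup-suc = solve-∀

shift-suc : ∀ x w u → suc (suc (x + w) + u) ≡ suc (suc x + u) + w
shift-suc = solve-∀

-- Sequences of labels ℓ : ℕ → Fin (suc m) in which label 0 marks a
-- "separator" and two adjacent positions with nonzero labels always
-- carry the same label (they lie in the same component).
module LabelSequence {m : ℕ} (ℓ : ℕ → Fin (suc m))
    (adjacent-agree : ∀ t → ℓ t ≢ fzero → ℓ (suc t) ≢ fzero → ℓ t ≡ ℓ (suc t)) where

  constant-from : ∀ a d → (∀ t → a ≤ t → t ≤ a + d → ℓ t ≢ fzero) → ℓ a ≡ ℓ (a + d)
  constant-from a zero _ = cong ℓ (sym (+-identityʳ a))
  constant-from a (suc d) nonzero rewrite +-suc a d =
    trans (constant-from a d (λ t a≤t t≤a+d → nonzero t a≤t (m≤n⇒m≤1+n t≤a+d)))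
          (adjacent-agree (a + d) (nonzero (a + d) (m≤m+n a d) (n≤1+n _))
                                  (nonzero (suc (a + d)) (m≤n⇒m≤1+n (m≤m+n a d)) ≤-refl))

  constant-on : ∀ a b → a ≤ b → (∀ t → a ≤ t → t ≤ b → ℓ t ≢ fzero) → ℓ a ≡ ℓ b
  constant-on a b a≤b with m≤n⇒∃[o]m+o≡n a≤b
  ... | d , refl = constant-from a d

  record Change (bound : ℕ) : Set where
    field
      left right : ℕ
      apart     : suc left < right
      right≤    : right ≤ bound
      left≢0    : ℓ left ≢ fzero
      right≢0   : ℓ right ≢ fzero
      distinct  : ℓ left ≢ ℓ right
      between   : ∀ t → left < t → t < right → ℓ t ≡ fzero

  change-weaken : ∀ {j k} → j ≤ k → Change j → Change k
  change-weaken j≤k c = record { left = left ; right = right ; apart = apart ; right≤ = ≤-trans right≤ j≤k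
                               ; left≢0 = left≢0 ; right≢0 = right≢0 ; distinct = distinct ; between = between }
    where open Change c

  apart-if-distinct : ∀ {x y} → x < y → ℓ x ≢ fzero → ℓ y ≢ fzero → ℓ x ≢ ℓ y → suc x < y
  apart-if-distinct {x} x<y x≢0 y≢0 x≢y with m≤n⇒m<n∨m≡n x<y
  ... | inj₁ 1+x<y = 1+x<y
  ... | inj₂ refl = ⊥-elim (x≢y (adjacent-agree x x≢0 y≢0))

  change-before : ∀ j y → j < y → (∀ t → j < t → t < y → ℓ t ≡ fzero) →
                  ℓ 0 ≢ fzero → ℓ y ≢ fzero → ℓ 0 ≢ ℓ y → Change y
  change-before zero y 0<y between 0≢0 y≢0 0≢y =
    record { left = 0 ; right = y ; apart = apart-if-distinct 0<y 0≢0 y≢0 0≢y ; right≤ = ≤-refl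
           ; left≢0 = 0≢0 ; right≢0 = y≢0 ; distinct = 0≢y ; between = between }
  change-before (suc j) y j<y between 0≢0 y≢0 0≢y with ℓ (suc j) ≟F fzero
  ... | yes j-sep = change-before j y (<⇒≤ j<y) between′ 0≢0 y≢0 0≢y
    where
    between′ : ∀ t → j < t → t < y → ℓ t ≡ fzero
    between′ t j<t t<y with m≤n⇒m<n∨m≡n j<t
    ... | inj₁ 1+j<t = between t 1+j<t t<y
    ... | inj₂ refl = j-sep
  ... | no j≢0 with ℓ (suc j) ≟F ℓ y
  ...   | no j≢y = record { left = suc j ; right = y ; apart = apart-if-distinct j<y j≢0 y≢0 j≢y
                          ; right≤ = ≤-refl ; left≢0 = j≢0 ; right≢0 = y≢0 ; distinct = j≢y
                          ; between = between }
  ...   | yes j≡y = change-weaken (<⇒≤ j<y)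
                      (change-before j (suc j) ≤-refl (λ t j<t t≤j → ⊥-elim (<⇒≱ t≤j j<t))
                                     0≢0 j≢0 (λ e → 0≢y (trans e j≡y)))

  label-change : ∀ y → ℓ 0 ≢ fzero → ℓ y ≢ fzero → ℓ 0 ≢ ℓ y → Change y
  label-change zero _ _ 0≢0 = ⊥-elim (0≢0 refl)
  label-change (suc y) = change-before y (suc y) ≤-refl (λ t y<t t≤y → ⊥-elim (<⇒≱ t≤y y<t))

module Walks {n : ℕ} (G : Graph n) where

  E-sym : ∀ {u v} → E G u v → E G v u
  E-sym {u} {v} e = trans (Graph.sym G v u) e

  E-irrefl : ∀ {u} → ¬ E G u u
  E-irrefl {u} e with trans (sym (Graph.irrefl G u)) e
  ... | ()

  module _ {Y : VSet n} where

    walk-start : ∀ {u v} → Walk G Y u v → Y u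
    walk-start (here y) = y
    walk-start (step y _ _) = y

    walk-end : ∀ {u v} → Walk G Y u v → Y v
    walk-end (here y) = y
    walk-end (step _ _ w) = walk-end w

    walk-++ : ∀ {u v w} → Walk G Y u v → Walk G Y v w → Walk G Y u w
    walk-++ (here _) q = q
    walk-++ (step y e p) q = step y e (walk-++ p q)

    walk-reverse : ∀ {u v} → Walk G Y u v → Walk G Y v u
    walk-reverse (here y) = here y
    walk-reverse (step y e p) = walk-++ (walk-reverse p) (step (walk-start p) (E-sym e) (here y))

    edge-walk : ∀ {u v} → Y u → Y v → E G u v → Walk G Y u v
    edge-walk yu yv e = step yu e (here yv)

CycSucc : ℕ → ℕ → ℕ → Set
CycSucc L c d = suc c ≡ d ⊎ (suc c ≡ L × d ≡ 0)

Consecutive : ℕ → ℕ → ℕ → Set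
Consecutive L c d = CycSucc L c d ⊎ CycSucc L d c

far⇒¬consecutive : ∀ {L a b} → a + 2 ≤ b → (0 < a ⊎ suc b < L) → ¬ Consecutive L a b
far⇒¬consecutive a+2≤b _ (inj₁ (inj₁ refl)) = 1+n≰n (≤-trans (≤-reflexive (+-comm 2 _)) a+2≤b)
far⇒¬consecutive a+2≤b _ (inj₁ (inj₂ (_ , refl))) with ≤-trans (m≤n+m 2 _) a+2≤b
... | ()
far⇒¬consecutive {b = b} a+2≤b _ (inj₂ (inj₁ refl)) = 1+n≰n (≤-trans (m≤m+n (suc b) 2) a+2≤b)
far⇒¬consecutive a+2≤b (inj₁ ()) (inj₂ (inj₂ (_ , refl)))
far⇒¬consecutive a+2≤b (inj₂ 1+b<L) (inj₂ (inj₂ (refl , _))) = 1+n≰n 1+b<L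

module Enumerations {n : ℕ} (G : Graph n) (H : Subset n) where
  open Walks G

  record Enumeration (C : Hole G H) : Set where
    field
      L0        : ℕ
      length≡   : len C ≡ 4 + L0
      g         : ℕ → Fin n
      g-inj     : ∀ c d → g c ≡ g d → c ≡[ 4 + L0 ] d
      g-periodic : ∀ c d → c ≡[ 4 + L0 ] d → g c ≡ g d
      g-step    : ∀ c → E G (g c) (g (suc c))
      g-edge    : ∀ c d → E G (g c) (g d) → suc c ≡[ 4 + L0 ] d ⊎ suc d ≡[ 4 + L0 ] c
      g-∈H      : ∀ c → g c ∈ H
      g-∈C      : ∀ c → V G C (g c)
      g-onto    : ∀ v → V G C v → ∃ λ c → g c ≡ v

  module Reading (C : Hole G H) where
    L L0 : ℕ
    L = len C
    L0 = L ∸ 4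
    length≡ : L ≡ 4 + L0
    length≡ = sym (m+[n∸m]≡n (len≥4 C))
    instance
      L≢0 : NonZero L
      L≢0 = subst NonZero (sym length≡) _
    open Remainder L
    pos : ℕ → Fin L
    pos c = fromℕ< (m%n<n c L)
    pos≡ : ∀ c → toℕ (pos c) ≡ c % L
    pos≡ c = toℕ-fromℕ< (m%n<n c L)
    g : ℕ → Fin n
    g c = node C (pos c)
    g-inj : ∀ c d → g c ≡ g d → c ≡[ L ] d
    g-inj c d e = %-≡⇒≡[] c d (trans (sym (pos≡ c)) (trans (cong toℕ (Hole.inj C e)) (pos≡ d)))
    g-periodic : ∀ c d → c ≡[ L ] d → g c ≡ g d
    g-periodic c d c≡d = cong (node C) (toℕ-injective (trans (pos≡ c) (trans (≡[]⇒%-≡ c d c≡d) (sym (pos≡ d)))))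
    g-step : ∀ c → E G (g c) (g (suc c))
    g-step c = proj₂ (induced C (pos c) (pos (suc c))) cyc-adj
      where
      cyc-adj : CycAdj G L (pos c) (pos (suc c))
      cyc-adj with suc-% c
      ... | inj₁ e = inj₁ (trans (cong suc (pos≡ c)) (trans (sym e) (sym (pos≡ (suc c)))))
      ... | inj₂ (e₁ , e₂) = inj₂ (inj₂ (inj₂ (trans (pos≡ (suc c)) e₂ , trans (cong suc (pos≡ c)) e₁)))
    g-edge : ∀ c d → E G (g c) (g d) → suc c ≡[ L ] d ⊎ suc d ≡[ L ] c
    g-edge c d e with proj₁ (induced C (pos c) (pos d)) e
    ... | inj₁ x = inj₁ (suc-%⇒≡[] c d (trans (cong suc (sym (pos≡ c))) (trans x (pos≡ d))))
    ... | inj₂ (inj₁ x) = inj₂ (suc-%⇒≡[] d c (trans (cong suc (sym (pos≡ d))) (trans x (pos≡ c))))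
    ... | inj₂ (inj₂ (inj₁ (x , y))) = inj₂ (wrap-%⇒≡[] c d (trans (sym (pos≡ c)) x) (trans (cong suc (sym (pos≡ d))) y))
    ... | inj₂ (inj₂ (inj₂ (x , y))) = inj₁ (wrap-%⇒≡[] d c (trans (sym (pos≡ d)) x) (trans (cong suc (sym (pos≡ c))) y))
    g-onto : ∀ v → V G C v → ∃ λ c → g c ≡ v
    g-onto v (i , e) = toℕ i , trans (cong (node C) (toℕ-injective (trans (pos≡ (toℕ i)) (m<n⇒m%n≡m (toℕ<n i))))) e

  -- Every hole has a periodic enumeration.  (Opaque, so that type
  -- checking never unfolds the remainder arithmetic behind it.)
  opaque
    enumerate : (C : Hole G H) → Enumeration C
    enumerate C = record
      { L0 = L0 ; length≡ = length≡ ; g = g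
      ; g-inj = λ c d e → subst (λ M → c ≡[ M ] d) length≡ (g-inj c d e)
      ; g-periodic = λ c d c≡d → g-periodic c d (subst (λ M → c ≡[ M ] d) (sym length≡) c≡d)
      ; g-step = g-step
      ; g-edge = λ c d e → ⊎-map (subst (λ M → suc c ≡[ M ] d) length≡)
                                 (subst (λ M → suc d ≡[ M ] c) length≡) (g-edge c d e)
      ; g-∈H = λ c → inH C (pos c)
      ; g-∈C = λ c → pos c , refl
      ; g-onto = g-onto }
      where open Reading C

  rotate : ∀ {C} → Enumeration C → ℕ → Enumeration C
  rotate {C} K r = record
    { L0 = L0 ; length≡ = length≡ ; g = λ c → g (r + c)
    ; g-inj = λ c d e → ≡[]-cancelˡ r c d (g-inj (r + c) (r + d) e)
    ; g-periodic = λ c d c≡d → g-periodic (r + c) (r + d) (≡[]-+ˡ r c d c≡d)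
    ; g-step = λ c → subst (λ z → E G (g (r + c)) (g z)) (sym (+-suc r c)) (g-step (r + c))
    ; g-edge = g-edge′
    ; g-∈H = λ c → g-∈H (r + c)
    ; g-∈C = λ c → g-∈C (r + c)
    ; g-onto = g-onto′ }
    where
    open Enumeration K
    L = 4 + L0
    g-edge′ : ∀ c d → E G (g (r + c)) (g (r + d)) → suc c ≡[ L ] d ⊎ suc d ≡[ L ] c
    g-edge′ c d e with g-edge (r + c) (r + d) e
    ... | inj₁ m = inj₁ (≡[]-cancelˡ r (suc c) d (subst (λ z → z ≡[ L ] r + d) (sym (+-suc r c)) m))
    ... | inj₂ m = inj₂ (≡[]-cancelˡ r (suc d) c (subst (λ z → z ≡[ L ] r + c) (sym (+-suc r d)) m))
    -- position c₀ of the original enumeration is position c₀ + r L - r here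
    g-onto′ : ∀ v → V G C v → ∃ λ c → g (r + c) ≡ v
    g-onto′ v v∈C with g-onto v v∈C
    ... | c₀ , e = (c₀ + r * L) ∸ r , trans (g-periodic _ c₀ (r , inj₂ (sym r+[c₀+rL∸r]))) e
      where
      r+[c₀+rL∸r] : r + ((c₀ + r * L) ∸ r) ≡ c₀ + r * L
      r+[c₀+rL∸r] = m+[n∸m]≡n (≤-trans (m≤m*n r L) (m≤n+m (r * L) c₀))

  module Positions {C : Hole G H} (K : Enumeration C) where
    open Enumeration K public

    L : ℕ
    L = 4 + L0

    onto-below : ∀ v → V G C v → ∃ λ t → t < L × g t ≡ v
    onto-below v v∈C with g-onto v v∈C
    ... | c , e = c % L , m%n<n c L , trans (g-periodic (c % L) c (c / L , inj₁ (sym (m≡m%n+[m/n]*n c L)))) e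

    inj-below : ∀ {t u} → t < L → u < L → g t ≡ g u → t ≡ u
    inj-below t<L u<L e = ≡[]-below⇒≡ t<L u<L (g-inj _ _ e)

    distinct-below : ∀ {t u} → t < L → u < L → t ≢ u → g t ≢ g u
    distinct-below t<L u<L t≢u e = t≢u (inj-below t<L u<L e)

    edge-below : ∀ {t u} → t < L → u < L → E G (g t) (g u) → Consecutive L t u
    edge-below t<L u<L e with g-edge _ _ e
    ... | inj₁ m = inj₁ (≡[]-suc-below t<L u<L m)
    ... | inj₂ m = inj₂ (≡[]-suc-below u<L t<L m)

    non-edge : ∀ {a b} → a + 2 ≤ b → b < L → (0 < a ⊎ suc b < L) → ¬ E G (g a) (g b)
    non-edge {a} a+2≤b b<L inner e =
      far⇒¬consecutive a+2≤b inner (edge-below (<-≤-trans (m<m+n a (s≤s z≤n)) (≤-trans a+2≤b (<⇒≤ b<L))) b<L e)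

    wrap-edge : E G (g (3 + L0)) (g 0)
    wrap-edge = subst (E G (g (3 + L0))) (g-periodic L 0 (1 , inj₂ (+-identityʳ L))) (g-step (3 + L0))

module Components {n : ℕ} (G : Graph n) (H S : Subset n) where
  open Walks G

  H∖S : VSet n
  H∖S = _∖_ G H S

  H∖S? : ∀ v → Dec (H∖S v)
  H∖S? v = (v ∈? H) ×-dec ¬? (v ∈? S)

  Covered : Hole G H → Set
  Covered C = ∃ λ b → H∖S b × (∀ v → V G C v → Walk G H∖S b v ⊎ v ∈ S)

  module Labelling {k : ℕ} (rep : Fin k → Fin n)
      (rep-unique : ∀ i j → Walk G H∖S (rep i) (rep j) → i ≡ j)
      (rep-covers : ∀ v → H∖S v → ∃ λ i → Walk G H∖S (rep i) v) where

    label-by : ∀ v → Dec (H∖S v) → Fin (suc k)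
    label-by v (yes v∈) = fsuc (proj₁ (rep-covers v v∈))
    label-by v (no _) = fzero

    label : Fin n → Fin (suc k)
    label v = label-by v (H∖S? v)

    label-rep : ∀ v → H∖S v → ∃ λ i → label v ≡ fsuc i × Walk G H∖S (rep i) v
    label-rep v v∈ with H∖S? v
    ... | yes v∈′ = proj₁ (rep-covers v v∈′) , refl , proj₂ (rep-covers v v∈′)
    ... | no v∉ = ⊥-elim (v∉ v∈)

    label≢0⇒H∖S : ∀ v → label v ≢ fzero → H∖S v
    label≢0⇒H∖S v l≢0 with H∖S? v
    ... | yes v∈ = v∈
    ... | no _ = ⊥-elim (l≢0 refl)

    H∖S⇒label≢0 : ∀ v → H∖S v → label v ≢ fzero
    H∖S⇒label≢0 v v∈ l≡0 with label-rep v v∈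
    ... | i , l≡i , _ with trans (sym l≡0) l≡i
    ... | ()

    label0⇒∈S : ∀ v → v ∈ H → label v ≡ fzero → v ∈ S
    label0⇒∈S v v∈H l≡0 = decidable-stable (v ∈? S) λ v∉S → H∖S⇒label≢0 v (v∈H , v∉S) l≡0

    walk⇒same-label : ∀ {u v} → Walk G H∖S u v → label u ≡ label v
    walk⇒same-label {u} {v} w with label-rep u (walk-start w) | label-rep v (walk-end w)
    ... | i , eu , wu | j , ev , wv =
      trans eu (trans (cong fsuc (rep-unique i j (walk-++ (walk-++ wu w) (walk-reverse wv)))) (sym ev))

    same-label⇒walk : ∀ {u v} → label u ≡ label v → label u ≢ fzero → Walk G H∖S u v
    same-label⇒walk {u} {v} e u≢0 with label-rep u (label≢0⇒H∖S u u≢0)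
                                     | label-rep v (label≢0⇒H∖S v (λ v≡0 → u≢0 (trans e v≡0)))
    ... | i , eu , wu | j , ev , wv with trans (sym eu) (trans e ev)
    ... | refl = walk-++ (walk-reverse wu) wv

module FullStar {n : ℕ} (G : Graph n) (H S : Subset n)
    (s : Fin n) (s∈S : s ∈ S)
    (S⊆N[s] : ∀ v → v ∈ S → v ∈ H × (v ≡ s ⊎ E G s v))
    (N[s]⊆S : ∀ v → v ∈ H → (v ≡ s ⊎ E G s v) → v ∈ S)
    {k : ℕ} (rep : Fin k → Fin n)
    (rep-unique : ∀ i j → Walk G (_∖_ G H S) (rep i) (rep j) → i ≡ j)
    (rep-covers : ∀ v → _∖_ G H S v → ∃ λ i → Walk G (_∖_ G H S) (rep i) v) where

  open Walks G
  open Enumerations G H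
  open Components G H S public
  open Labelling rep rep-unique rep-covers public

  s∈H : s ∈ H
  s∈H = proj₁ (S⊆N[s] s s∈S)

  -- Labels along an enumerated hole; positions with label 0 are the
  -- "separators", i.e. the nodes of C in S.
  module AlongHole {C : Hole G H} (K : Enumeration C) where
    open Positions K public

    ℓ : ℕ → Fin (suc k)
    ℓ t = label (g t)

    consecutive-agree : ∀ t → ℓ t ≢ fzero → ℓ (suc t) ≢ fzero → ℓ t ≡ ℓ (suc t)
    consecutive-agree t t≢0 t+1≢0 =
      walk⇒same-label (edge-walk (label≢0⇒H∖S _ t≢0) (label≢0⇒H∖S _ t+1≢0) (g-step t))

    open LabelSequence ℓ consecutive-agree public

    ℓ-periodic : ∀ t → ℓ (L + t) ≡ ℓ t
    ℓ-periodic t = cong label (g-periodic (L + t) t (≡[]-period t))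

    separator⇒∈S : ∀ t → ℓ t ≡ fzero → g t ∈ S
    separator⇒∈S t t≡0 = label0⇒∈S (g t) (g-∈H t) t≡0

    nonzero⇒¬adj : ∀ t → ℓ t ≢ fzero → ¬ E G s (g t)
    nonzero⇒¬adj t t≢0 e = proj₂ (label≢0⇒H∖S (g t) t≢0) (N[s]⊆S (g t) (g-∈H t) (inj₂ e))

    adj⇒separator : ∀ t → E G s (g t) → ℓ t ≡ fzero
    adj⇒separator t e = decidable-stable (ℓ t ≟F fzero) λ t≢0 → nonzero⇒¬adj t t≢0 e

    separator? : ∀ a b → (∃ λ z → a ≤ z × z ≤ b × ℓ z ≡ fzero) ⊎ (∀ z → a ≤ z → z ≤ b → ℓ z ≢ fzero)
    separator? a b with anyUpTo? (λ z → (a ≤? z) ×-dec (ℓ z ≟F fzero)) (suc b)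
    ... | yes (z , z<1+b , a≤z , z≡0) = inj₁ (z , a≤z , ≤-pred z<1+b , z≡0)
    ... | no none = inj₂ λ z a≤z z≤b z≡0 → none (z , s≤s z≤b , a≤z , z≡0)

  -- If s lies on C then, rotating C so that s sits at position L0 + 2,
  -- the positions 0 … L0 are exactly the nodes of C outside N[s] = S:
  -- they form a path in H ∖ S, so C is covered.
  module OnHole (C : Hole G H) (s∈C : V G C s) where
    c₀ : ℕ
    c₀ = proj₁ (Enumeration.g-onto (enumerate C) s s∈C)

    open AlongHole (rotate (enumerate C) (c₀ + 2))

    s-position : g (2 + L0) ≡ s
    s-position = trans (Enumeration.g-periodic (enumerate C) (c₀ + 2 + (2 + L0)) c₀ (1 , inj₂ (one-turn c₀ L0)))
                       (proj₂ (Enumeration.g-onto (enumerate C) s s∈C))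

    2+L0<L : 2 + L0 < L
    2+L0<L = s≤s (s≤s (s≤s (n≤1+n _)))

    ≤L0⇒<L : ∀ {t} → t ≤ L0 → t < L
    ≤L0⇒<L t≤L0 = s≤s (≤-trans t≤L0 (≤-trans (n≤1+n _) (≤-trans (n≤1+n _) (n≤1+n _))))

    beyond-L0 : ∀ {t} j → t ≡ suc j + L0 → ¬ t ≤ L0
    beyond-L0 j refl t≤L0 = 1+n≰n (≤-trans (s≤s (m≤n+m L0 j)) t≤L0)

    -- The nodes of S on C are s and its two neighbours on C, at
    -- positions L0 + 1, L0 + 2, L0 + 3.
    far-from-s : ∀ t → t ≤ L0 → ℓ t ≢ fzero
    far-from-s t t≤L0 t≡0 with proj₂ (S⊆N[s] (g t) (separator⇒∈S t t≡0))
    ... | inj₁ t-is-s = beyond-L0 1 (inj-below (≤L0⇒<L t≤L0) 2+L0<L (trans t-is-s (sym s-position))) t≤L0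
    ... | inj₂ s~t with edge-below 2+L0<L (≤L0⇒<L t≤L0) (subst (λ z → E G z (g t)) (sym s-position) s~t)
    ...   | inj₁ (inj₁ e) = beyond-L0 2 (sym e) t≤L0
    ...   | inj₁ (inj₂ (e , _)) = 1+n≢n (sym e)
    ...   | inj₂ (inj₁ e) = beyond-L0 0 (suc-injective e) t≤L0
    ...   | inj₂ (inj₂ (_ , ()))

    near-s : ∀ t → suc L0 ≤ t → t < L → g t ∈ S
    near-s t L0<t t<L with m≤n⇒m<n∨m≡n L0<t
    ... | inj₂ refl = N[s]⊆S (g t) (g-∈H t) (inj₂ (subst (λ z → E G z (g (1 + L0))) s-position (E-sym (g-step (1 + L0)))))
    ... | inj₁ 1+L0<t with m≤n⇒m<n∨m≡n 1+L0<t
    ...   | inj₂ refl = subst (_∈ S) (sym s-position) s∈S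
    ...   | inj₁ 2+L0<t with ≤-antisym (≤-pred t<L) 2+L0<t
    ...     | refl = N[s]⊆S (g t) (g-∈H t) (inj₂ (subst (λ z → E G z (g (3 + L0))) s-position (g-step (2 + L0))))

    covered : Covered C
    covered = g 0 , label≢0⇒H∖S (g 0) (far-from-s 0 z≤n) , in-component
      where
      in-component : ∀ v → V G C v → Walk G H∖S (g 0) v ⊎ v ∈ S
      in-component v v∈C with onto-below v v∈C
      ... | t , t<L , refl with t ≤? L0
      ...   | yes t≤L0 = inj₁ (same-label⇒walk (constant-on 0 t z≤n (λ u _ u≤t → far-from-s u (≤-trans u≤t t≤L0)))
                                                (far-from-s 0 z≤n))
      ...   | no t≰L0 = inj₂ (near-s t (≰⇒> t≰L0) t<L)

  -- If s is adjacent to positions 0 and q of C (2 ≤ q, q + 1 < L) and to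
  -- no position strictly between, then g 0, …, g q, s is a hole of length
  -- q + 2.
  module DetourHole {C : Hole G H} (K : Enumeration C) (s∉C : ¬ V G C s)
      (q : ℕ) (2≤q : 2 ≤ q) (q+1<L : suc q < 4 + Enumeration.L0 K)
      (s~first : E G s (Enumeration.g K 0)) (s~last : E G s (Enumeration.g K q))
      (s≁inner : ∀ t → 0 < t → t < q → ¬ E G s (Enumeration.g K t)) where
    open Positions K

    node′ : ℕ → Fin n
    node′ t with t ≤? q
    ... | yes _ = g t
    ... | no _ = s

    node′-path : ∀ t → t ≤ q → node′ t ≡ g t
    node′-path t t≤q with t ≤? q
    ... | yes _ = refl
    ... | no t≰q = ⊥-elim (t≰q t≤q)

    node′-s : node′ (suc q) ≡ s
    node′-s with suc q ≤? q
    ... | yes q+1≤q = ⊥-elim (1+n≰n q+1≤q)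
    ... | no _ = refl

    position : (i : Fin (2 + q)) → toℕ i ≤ q ⊎ toℕ i ≡ suc q
    position i with m≤n⇒m<n∨m≡n (≤-pred (toℕ<n i))
    ... | inj₁ lt = inj₁ (≤-pred lt)
    ... | inj₂ e = inj₂ e

    path<L : ∀ {t} → t ≤ q → t < L
    path<L t≤q = ≤-trans (s≤s t≤q) (<⇒≤ q+1<L)

    s∉path : ∀ {t} → g t ≢ s
    s∉path {t} e = s∉C (subst (V G C) e (g-∈C t))

    node′-inj : ∀ {i j} → node′ (toℕ i) ≡ node′ (toℕ j) → i ≡ j
    node′-inj {i} {j} e with position i | position j
    ... | inj₁ a | inj₁ b = toℕ-injective (inj-below (path<L a) (path<L b) (trans (sym (node′-path _ a)) (trans e (node′-path _ b))))
    ... | inj₁ a | inj₂ b = ⊥-elim (s∉path (trans (sym (node′-path _ a)) (trans e (trans (cong node′ b) node′-s))))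
    ... | inj₂ a | inj₁ b = ⊥-elim (s∉path (trans (sym (node′-path _ b)) (trans (sym e) (trans (cong node′ a) node′-s))))
    ... | inj₂ a | inj₂ b = toℕ-injective (trans a (sym b))

    node′-∈H : ∀ i → node′ (toℕ i) ∈ H
    node′-∈H i with position i
    ... | inj₁ a = subst (_∈ H) (sym (node′-path _ a)) (g-∈H _)
    ... | inj₂ a = subst (_∈ H) (sym (trans (cong node′ a) node′-s)) s∈H

    CycAdjℕ : ℕ → ℕ → Set
    CycAdjℕ a b = suc a ≡ b ⊎ suc b ≡ a ⊎ (a ≡ 0 × suc b ≡ 2 + q) ⊎ (b ≡ 0 × suc a ≡ 2 + q)

    CycAdjℕ-sym : ∀ {a b} → CycAdjℕ a b → CycAdjℕ b a
    CycAdjℕ-sym (inj₁ x) = inj₂ (inj₁ x)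
    CycAdjℕ-sym (inj₂ (inj₁ x)) = inj₁ x
    CycAdjℕ-sym (inj₂ (inj₂ (inj₁ x))) = inj₂ (inj₂ (inj₂ x))
    CycAdjℕ-sym (inj₂ (inj₂ (inj₂ x))) = inj₂ (inj₂ (inj₁ x))

    -- Within the path g 0 … g q the edges are those of C, between
    -- consecutive positions.
    path-path : ∀ a b → a ≤ q → b ≤ q → (E G (g a) (g b) → CycAdjℕ a b) × (CycAdjℕ a b → E G (g a) (g b))
    path-path a b a≤q b≤q = to , from
      where
      no-wrap : ∀ {c} → c ≤ q → suc c ≢ L
      no-wrap c≤q e = <-irrefl e (≤-trans (s≤s (s≤s c≤q)) q+1<L)
      to : E G (g a) (g b) → CycAdjℕ a b
      to e with edge-below (path<L a≤q) (path<L b≤q) e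
      ... | inj₁ (inj₁ x) = inj₁ x
      ... | inj₁ (inj₂ (x , _)) = ⊥-elim (no-wrap a≤q x)
      ... | inj₂ (inj₁ x) = inj₂ (inj₁ x)
      ... | inj₂ (inj₂ (x , _)) = ⊥-elim (no-wrap b≤q x)
      from : CycAdjℕ a b → E G (g a) (g b)
      from (inj₁ refl) = g-step a
      from (inj₂ (inj₁ refl)) = E-sym (g-step b)
      from (inj₂ (inj₂ (inj₁ (_ , x)))) = ⊥-elim (1+n≰n (≤-trans (≤-reflexive (sym (suc-injective x))) b≤q))
      from (inj₂ (inj₂ (inj₂ (_ , x)))) = ⊥-elim (1+n≰n (≤-trans (≤-reflexive (sym (suc-injective x))) a≤q))

    s-neighbours-on-path : ∀ a → a ≤ q → E G s (g a) → a ≡ 0 ⊎ a ≡ q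
    s-neighbours-on-path zero _ _ = inj₁ refl
    s-neighbours-on-path (suc a) a≤q e with m≤n⇒m<n∨m≡n a≤q
    ... | inj₁ a<q = ⊥-elim (s≁inner (suc a) (s≤s z≤n) a<q e)
    ... | inj₂ a≡q = inj₂ a≡q

    path-s : ∀ a → a ≤ q → (E G (g a) s → CycAdjℕ a (suc q)) × (CycAdjℕ a (suc q) → E G (g a) s)
    path-s a a≤q = to (s-neighbours-on-path a a≤q) , from
      where
      to : (E G s (g a) → a ≡ 0 ⊎ a ≡ q) → E G (g a) s → CycAdjℕ a (suc q)
      to ends e with ends (E-sym e)
      ... | inj₁ a≡0 = inj₂ (inj₂ (inj₁ (a≡0 , refl)))
      ... | inj₂ a≡q = inj₁ (cong suc a≡q)
      from : CycAdjℕ a (suc q) → E G (g a) s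
      from (inj₁ x) = E-sym (subst (λ z → E G s (g z)) (sym (suc-injective x)) s~last)
      from (inj₂ (inj₁ x)) = ⊥-elim (1+n≰n (≤-trans (≤-reflexive x) (≤-trans a≤q (n≤1+n _))))
      from (inj₂ (inj₂ (inj₁ (refl , _)))) = E-sym s~first
      from (inj₂ (inj₂ (inj₂ (() , _))))

    induced′ : ∀ a b → (a ≤ q ⊎ a ≡ suc q) → (b ≤ q ⊎ b ≡ suc q) →
               (E G (node′ a) (node′ b) → CycAdjℕ a b) × (CycAdjℕ a b → E G (node′ a) (node′ b))
    induced′ a b (inj₁ a≤q) (inj₁ b≤q) rewrite node′-path a a≤q | node′-path b b≤q = path-path a b a≤q b≤q
    induced′ a b (inj₁ a≤q) (inj₂ refl) rewrite node′-path a a≤q | node′-s = path-s a a≤q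
    induced′ a b (inj₂ refl) (inj₁ b≤q) rewrite node′-path b b≤q | node′-s =
      (λ e → CycAdjℕ-sym (proj₁ (path-s b b≤q) (E-sym e))) , (λ c → E-sym (proj₂ (path-s b b≤q) (CycAdjℕ-sym c)))
    induced′ a b (inj₂ refl) (inj₂ refl) rewrite node′-s = (λ e → ⊥-elim (E-irrefl e)) , not-self
      where
      not-self : CycAdjℕ (suc q) (suc q) → E G s s
      not-self (inj₁ x) = ⊥-elim (<-irrefl (sym x) ≤-refl)
      not-self (inj₂ (inj₁ x)) = ⊥-elim (<-irrefl (sym x) ≤-refl)
      not-self (inj₂ (inj₂ (inj₁ (() , _))))
      not-self (inj₂ (inj₂ (inj₂ (() , _))))

    hole : Hole G H
    hole = record
      { len = 2 + q ; len≥4 = s≤s (s≤s 2≤q) ; node = λ i → node′ (toℕ i) ; inj = node′-inj ; inH = node′-∈H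
      ; induced = λ i j → induced′ (toℕ i) (toℕ j) (position i) (position j) }

  -- (B2) with components named by labels: s₁ sees x₁ and x₂, s₂ sees y₁
  -- and y₂, where x₁, y₁ share one component and x₂, y₂ share another.
  B2ByLabels : Set
  B2ByLabels = ∃ λ s₁ → ∃ λ s₂ → ∃ λ x₁ → ∃ λ x₂ → ∃ λ y₁ → ∃ λ y₂ →
    s₁ ∈ S × s₂ ∈ S × s₁ ≢ s₂ × ¬ E G s₁ s₂ ×
    E G s₁ x₁ × E G s₁ x₂ × E G s₂ y₁ × E G s₂ y₂ ×
    label x₁ ≡ label y₁ × label x₂ ≡ label y₂ × label x₁ ≢ label x₂ × label x₁ ≢ fzero × label x₂ ≢ fzero

  module OffHole {C : Hole G H} (K : Enumeration C) (s∉C : ¬ V G C s) where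
    open AlongHole K public

    separator⇒adj : ∀ t → ℓ t ≡ fzero → E G s (g t)
    separator⇒adj t t≡0 with proj₂ (S⊆N[s] (g t) (separator⇒∈S t t≡0))
    ... | inj₁ t-is-s = ⊥-elim (s∉C (subst (V G C) t-is-s (g-∈C t)))
    ... | inj₂ s~t = s~t

    separator⇒N_C : ∀ t → ℓ t ≡ fzero → N_C G C s (g t)
    separator⇒N_C t t≡0 = g-∈C t , separator⇒adj t t≡0

    three-separators⇒major : ∀ a b c → 2 + a ≤ b → 2 + b ≤ c → c < L → (0 < a ⊎ suc c < L) →
                             ℓ a ≡ fzero → ℓ b ≡ fzero → ℓ c ≡ fzero → Major G H C s
    three-separators⇒major a b c a+2≤b b+2≤c c<L inner a≡0 b≡0 c≡0 =
      s∈H , s∉C , g a , g b , g c , separator⇒N_C a a≡0 , separator⇒N_C b b≡0 , separator⇒N_C c c≡0 ,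
      distinct-below a<L b<L (λ e → <-irrefl e (≤-trans (n≤1+n _) a+2≤b)) ,
      distinct-below b<L c<L (λ e → <-irrefl e (≤-trans (n≤1+n _) b+2≤c)) ,
      distinct-below a<L c<L (λ e → <-irrefl e (≤-trans (n≤1+n _) a+2≤c)) ,
      non-edge (+2≤ a+2≤b) b<L (inj₂ (≤-trans b+2≤c (<⇒≤ c<L))) ,
      non-edge (+2≤ b+2≤c) c<L (inj₁ (≤-trans (s≤s z≤n) a+2≤b)) ,
      non-edge (+2≤ a+2≤c) c<L inner
      where
      +2≤ : ∀ {x y} → 2 + x ≤ y → x + 2 ≤ y
      +2≤ {x} le = ≤-trans (≤-reflexive (+-comm x 2)) le
      a+2≤c : 2 + a ≤ c
      a+2≤c = ≤-trans a+2≤b (≤-trans (n≤1+n _) (≤-trans (n≤1+n _) b+2≤c))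
      b<L : b < L
      b<L = ≤-trans (n≤1+n (suc b)) (≤-trans b+2≤c (<⇒≤ c<L))
      a<L : a < L
      a<L = ≤-trans (≤-trans (n≤1+n _) a+2≤b) (<⇒≤ b<L)

    -- A stretch start … start + span of C whose two ends are separators
    -- and whose interior is not; with s it closes a hole.
    record Detour : Set where
      field
        start span : ℕ
        span≥2    : 2 ≤ span
        span<L    : suc span < L
        start-sep : ℓ start ≡ fzero
        end-sep   : ℓ (start + span) ≡ fzero
        inside    : ∀ t → 0 < t → t < span → ℓ (start + t) ≢ fzero

    detour-hole : (D : Detour) → Σ (Hole G H) λ C′ → len C′ ≡ 2 + Detour.span D
    detour-hole D = DetourHole.hole (rotate K start) s∉C span span≥2 span<L s~first s~last s≁inner , refl
      where
      open Detour D
      s~first : E G s (g (start + 0))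
      s~first = subst (λ z → E G s (g z)) (sym (+-identityʳ start)) (separator⇒adj start start-sep)
      s~last : E G s (g (start + span))
      s~last = separator⇒adj (start + span) end-sep
      s≁inner : ∀ t → 0 < t → t < span → ¬ E G s (g (start + t))
      s≁inner t 0<t t<span = nonzero⇒¬adj (start + t) (inside t 0<t t<span)

  module Analysis {C : Hole G H} (s∉C : ¬ V G C s) (clean : Clean G H C)
      (shortest : ShortestEvenHole G H C) where

    s-not-major : ¬ Major G H C s
    s-not-major = proj₁ (clean s)

    module At (K : Enumeration C) where
      open OffHole K s∉C public

      L-even : 2 ∣ L
      L-even = subst (2 ∣_) length≡ (proj₁ shortest)

      no-shorter-even : (C′ : Hole G H) → 2 ∣ len C′ → len C′ < L → ⊥
      no-shorter-even C′ even shorter = <⇒≱ shorter (subst (_≤ len C′) length≡ (proj₂ shortest C′ even))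

      shorter-detour : (D : Detour) → 2 ∣ 2 + Detour.span D → 2 + Detour.span D < L → ⊥
      shorter-detour D even shorter with detour-hole D
      ... | C′ , refl = no-shorter-even C′ even shorter

      -- Two detours whose holes have total length L + 3: by parity one of
      -- them is even, and it is shorter than C.
      two-detours⇒⊥ : (D₁ D₂ : Detour) → (2 + Detour.span D₁) + (2 + Detour.span D₂) ≡ L + 3 → ⊥
      two-detours⇒⊥ D₁ D₂ total with one-even _ _ L total L-even
      ... | inj₁ even₁ = shorter-detour D₁ even₁ (sum-bound total (s≤s (s≤s (Detour.span≥2 D₂))))
      ... | inj₂ even₂ = shorter-detour D₂ even₂
                           (sum-bound (trans (+-comm (2 + Detour.span D₂) _) total) (s≤s (s≤s (Detour.span≥2 D₁))))

      neighbour-in-N_C : ∀ p → p < L → ∀ w → E G (g p) w → N_C G C s w →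
                         ∃ λ t → t < L × g t ≡ w × Consecutive L p t × ℓ t ≡ fzero
      neighbour-in-N_C p p<L w p~w (w∈C , s~w) with onto-below w w∈C
      ... | t , t<L , refl = t , t<L , refl , edge-below p<L t<L p~w , adj⇒separator t s~w

      -- If the separators are exactly the two pairs x+1, x+2 and L0+2, L0+3,
      -- then C[N_C(s)] has exactly two components, each of two nodes.
      module DoubleGaps (x : ℕ) (x+2≤L0 : 2 + x ≤ L0)
          (arc₁ : ∀ t → t ≤ x → ℓ t ≢ fzero)
          (arc₂ : ∀ t → 3 + x ≤ t → t ≤ 1 + L0 → ℓ t ≢ fzero)
          (sep₁ : ℓ (1 + x) ≡ fzero) (sep₂ : ℓ (2 + x) ≡ fzero)
          (sep₃ : ℓ (2 + L0) ≡ fzero) (sep₄ : ℓ (3 + L0) ≡ fzero) where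

        x≤L0 : x ≤ L0
        x≤L0 = ≤-trans (n≤1+n _) (≤-trans (n≤1+n _) x+2≤L0)
        1+x<L : 1 + x < L
        1+x<L = s≤s (s≤s (≤-trans x≤L0 (≤-trans (n≤1+n _) (n≤1+n _))))
        2+x<L : 2 + x < L
        2+x<L = s≤s (s≤s (s≤s (≤-trans x≤L0 (n≤1+n _))))
        2+L0<L : 2 + L0 < L
        2+L0<L = s≤s (s≤s (s≤s (n≤1+n _)))
        3+L0<L : 3 + L0 < L
        3+L0<L = ≤-refl

        OuterPair InnerPair : Fin n → Set
        OuterPair u = u ≡ g (2 + L0) ⊎ u ≡ g (3 + L0)
        InnerPair u = u ≡ g (1 + x) ⊎ u ≡ g (2 + x)

        outer-closed : ∀ u w → OuterPair u → E G u w → N_C G C s w → OuterPair w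
        outer-closed u w (inj₁ refl) e w∈N with neighbour-in-N_C (2 + L0) 2+L0<L w e w∈N
        ... | t , _ , gt , inj₁ (inj₁ refl) , _ = inj₂ (sym gt)
        ... | t , _ , gt , inj₁ (inj₂ (x , _)) , _ = ⊥-elim (1+n≢n (sym x))
        ... | t , _ , gt , inj₂ (inj₁ refl) , t≡0 = ⊥-elim (arc₂ (1 + L0) (s≤s x+2≤L0) ≤-refl t≡0)
        ... | t , _ , gt , inj₂ (inj₂ (_ , ())) , _
        outer-closed u w (inj₂ refl) e w∈N with neighbour-in-N_C (3 + L0) 3+L0<L w e w∈N
        ... | t , t<L , gt , inj₁ (inj₁ refl) , _ = ⊥-elim (<-irrefl refl t<L)
        ... | t , _ , gt , inj₁ (inj₂ (_ , refl)) , t≡0 = ⊥-elim (arc₁ 0 z≤n t≡0)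
        ... | t , _ , gt , inj₂ (inj₁ refl) , _ = inj₁ (sym gt)
        ... | t , _ , gt , inj₂ (inj₂ (_ , ())) , _

        inner-closed : ∀ u w → InnerPair u → E G u w → N_C G C s w → InnerPair w
        inner-closed u w (inj₁ refl) e w∈N with neighbour-in-N_C (1 + x) 1+x<L w e w∈N
        ... | t , _ , gt , inj₁ (inj₁ refl) , _ = inj₂ (sym gt)
        ... | t , _ , gt , inj₁ (inj₂ (e′ , _)) , _ = ⊥-elim (<-irrefl e′ 2+x<L)
        ... | t , _ , gt , inj₂ (inj₁ refl) , t≡0 = ⊥-elim (arc₁ x ≤-refl t≡0)
        ... | t , _ , gt , inj₂ (inj₂ (_ , ())) , _
        inner-closed u w (inj₂ refl) e w∈N with neighbour-in-N_C (2 + x) 2+x<L w e w∈N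
        ... | t , _ , gt , inj₁ (inj₁ refl) , t≡0 = ⊥-elim (arc₂ (3 + x) ≤-refl (s≤s x+2≤L0) t≡0)
        ... | t , _ , gt , inj₁ (inj₂ (e′ , _)) , _ = ⊥-elim (<-irrefl e′ (s≤s (s≤s (s≤s (s≤s x≤L0)))))
        ... | t , _ , gt , inj₂ (inj₁ refl) , _ = inj₁ (sym gt)
        ... | t , _ , gt , inj₂ (inj₂ (_ , ())) , _

        walk-outer : ∀ {u v} → Walk G (N_C G C s) u v → OuterPair u → OuterPair v
        walk-outer (here _) p = p
        walk-outer (step _ e w) p = walk-outer w (outer-closed _ _ p e (walk-start w))

        walk-inner : ∀ {u v} → Walk G (N_C G C s) u v → InnerPair u → InnerPair v
        walk-inner (here _) p = p
        walk-inner (step _ e w) p = walk-inner w (inner-closed _ _ p e (walk-start w))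

        separators : ∀ t → t < L → ℓ t ≡ fzero → t ≡ 1 + x ⊎ t ≡ 2 + x ⊎ t ≡ 2 + L0 ⊎ t ≡ 3 + L0
        separators t t<L t≡0 with t ≤? x
        ... | yes t≤x = ⊥-elim (arc₁ t t≤x t≡0)
        ... | no t≰x with m≤n⇒m<n∨m≡n (≰⇒> t≰x)
        ...   | inj₂ e = inj₁ (sym e)
        ...   | inj₁ x+1<t with m≤n⇒m<n∨m≡n x+1<t
        ...     | inj₂ e = inj₂ (inj₁ (sym e))
        ...     | inj₁ x+2<t with t ≤? 1 + L0
        ...       | yes t≤1+L0 = ⊥-elim (arc₂ t x+2<t t≤1+L0 t≡0)
        ...       | no t≰1+L0 with m≤n⇒m<n∨m≡n (≰⇒> t≰1+L0)
        ...         | inj₂ e = inj₂ (inj₂ (inj₁ (sym e)))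
        ...         | inj₁ 2+L0<t = inj₂ (inj₂ (inj₂ (≤-antisym (≤-pred t<L) 2+L0<t)))

        N : VSet n
        N = N_C G C s

        outer₁ : N (g (2 + L0))
        outer₁ = separator⇒N_C (2 + L0) sep₃
        outer₂ : N (g (3 + L0))
        outer₂ = separator⇒N_C (3 + L0) sep₄
        inner₁ : N (g (1 + x))
        inner₁ = separator⇒N_C (1 + x) sep₁
        inner₂ : N (g (2 + x))
        inner₂ = separator⇒N_C (2 + x) sep₂

        outer-walk : Walk G N (g (3 + L0)) (g (2 + L0))
        outer-walk = step outer₂ (E-sym (g-step (2 + L0))) (here outer₁)
        inner-walk : Walk G N (g (1 + x)) (g (2 + x))
        inner-walk = step inner₁ (g-step (1 + x)) (here inner₂)

        pairs-apart : ¬ Walk G N (g (3 + L0)) (g (1 + x))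
        pairs-apart w with walk-outer w (inj₂ refl)
        ... | inj₁ e = <-irrefl (inj-below 1+x<L 2+L0<L e) (s≤s (s≤s x≤L0))
        ... | inj₂ e = <-irrefl (inj-below 1+x<L 3+L0<L e) (s≤s (s≤s (≤-trans x≤L0 (n≤1+n _))))

        pairs-cover : ∀ y → N y → Walk G N (g (3 + L0)) y ⊎ Walk G N (g (1 + x)) y
        pairs-cover y (y∈C , s~y) with onto-below y y∈C
        ... | t , t<L , refl with separators t t<L (adj⇒separator t s~y)
        ...   | inj₁ refl = inj₂ (here inner₁)
        ...   | inj₂ (inj₁ refl) = inj₂ inner-walk
        ...   | inj₂ (inj₂ (inj₁ refl)) = inj₁ outer-walk
        ...   | inj₂ (inj₂ (inj₂ refl)) = inj₁ (here outer₂)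

        outer-pair-exactly : ∀ r → Walk G N (g (3 + L0)) r → r ≡ g (3 + L0) ⊎ r ≡ g (2 + L0)
        outer-pair-exactly r w with walk-outer w (inj₂ refl)
        ... | inj₁ e = inj₂ e
        ... | inj₂ e = inj₁ e

        s∈N22 : N22 G H C s
        s∈N22 = s∈H , s∉C , s-not-major , (g (3 + L0) , outer₂) ,
                g (3 + L0) , g (1 + x) , outer₂ , inner₁ , pairs-apart , pairs-cover ,
                (g (3 + L0) , g (2 + L0) , distinct-below 3+L0<L 2+L0<L 1+n≢n , here outer₂ , outer-walk ,
                  outer-pair-exactly) ,
                (g (1 + x) , g (2 + x) , distinct-below 1+x<L 2+x<L (λ e → 1+n≢n (sym e)) , here inner₁ , inner-walk ,
                  λ r w → walk-inner w (inj₁ refl))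

      detour-around-0 : ∀ x → x ≤ L0 → (∀ t → t ≤ x → ℓ t ≢ fzero) →
                        ℓ (1 + x) ≡ fzero → ℓ (3 + L0) ≡ fzero → Detour
      detour-around-0 x x≤L0 arc sep sep′ = record
        { start = 3 + L0 ; span = 2 + x ; span≥2 = s≤s (s≤s z≤n) ; span<L = s≤s (s≤s (s≤s (s≤s x≤L0)))
        ; start-sep = sep′
        ; end-sep = trans (cong ℓ (+-suc (3 + L0) (suc x))) (trans (ℓ-periodic (suc x)) sep)
        ; inside = inside }
        where
        inside : ∀ t → 0 < t → t < 2 + x → ℓ (3 + L0 + t) ≢ fzero
        inside (suc t) _ t<1+x t≡0 =
          arc t (≤-pred (≤-pred t<1+x)) (trans (sym (ℓ-periodic t)) (trans (cong ℓ (sym (+-suc (3 + L0) t))) t≡0))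

      -- One gap of one separator and one of two: the detours through the
      -- two arcs have total length L + 3.
      mixed-gaps⇒⊥ : ∀ x d r → suc (x + d) ≡ L0 → (∀ t → t ≤ x → ℓ t ≢ fzero) →
                     ℓ (1 + x) ≡ fzero → ℓ (3 + L0) ≡ fzero → ℓ r ≡ fzero → ℓ (r + (2 + d)) ≡ fzero →
                     (∀ t → 0 < t → t < 2 + d → ℓ (r + t) ≢ fzero) → ⊥
      mixed-gaps⇒⊥ x d r x+d+1≡L0 arc sep₁ sep₂ sep₃ sep₄ inside =
        two-detours⇒⊥ (detour-around-0 x x≤L0 arc sep₁ sep₂) second (trans (detour-lengths x d) (cong (λ m → 4 + m + 3) x+d+1≡L0))
        where
        x≤L0 : x ≤ L0
        x≤L0 = ≤-trans (m≤m+n x d) (≤-trans (n≤1+n _) (≤-reflexive x+d+1≡L0))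
        second : Detour
        second = record { start = r ; span = 2 + d ; span≥2 = s≤s (s≤s z≤n)
                        ; span<L = s≤s (s≤s (s≤s (s≤s (≤-trans (m≤n+m d x) (≤-trans (n≤1+n _) (≤-reflexive x+d+1≡L0))))))
                        ; start-sep = sep₃ ; end-sep = sep₄ ; inside = inside }

      gaps-1-2⇒⊥ : ∀ x → 3 + x ≤ 2 + L0 → (∀ t → t ≤ x → ℓ t ≢ fzero) →
                   (∀ t → 3 + x ≤ t → t ≤ 2 + L0 → ℓ t ≢ fzero) →
                   ℓ (1 + x) ≡ fzero → ℓ (2 + x) ≡ fzero → ℓ (3 + L0) ≡ fzero → ⊥
      gaps-1-2⇒⊥ x x+3≤2+L0 arc₁ arc₂ sep₁ sep₂ sep₃ with m≤n⇒∃[o]m+o≡n (≤-pred (≤-pred x+3≤2+L0))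
      ... | d , x+d+1≡L0 =
        mixed-gaps⇒⊥ x d (2 + x) x+d+1≡L0 arc₁ sep₁ sep₃ sep₂
          (trans (cong ℓ (trans (detour-end₂ x d) (cong (3 +_) x+d+1≡L0))) sep₃) inside
        where
        inside : ∀ t → 0 < t → t < 2 + d → ℓ (2 + x + t) ≢ fzero
        inside (suc t) _ t<2+d = arc₂ (2 + x + suc t)
          (≤-trans (s≤s (s≤s (s≤s (m≤m+n x t)))) (≤-reflexive (sym (+-suc (2 + x) t))))
          (≤-trans (≤-reflexive (+-suc (2 + x) t))
                   (s≤s (s≤s (≤-trans (s≤s (+-monoʳ-≤ x (≤-pred (≤-pred t<2+d)))) (≤-reflexive x+d+1≡L0)))))

      gaps-2-1⇒⊥ : ∀ x → 2 + x ≤ 1 + L0 → (∀ t → t ≤ x → ℓ t ≢ fzero) →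
                   (∀ t → 2 + x ≤ t → t ≤ 1 + L0 → ℓ t ≢ fzero) →
                   ℓ (1 + x) ≡ fzero → ℓ (2 + L0) ≡ fzero → ℓ (3 + L0) ≡ fzero → ⊥
      gaps-2-1⇒⊥ x x+2≤1+L0 arc₁ arc₂ sep₁ sep₂ sep₃ with m≤n⇒∃[o]m+o≡n (≤-pred x+2≤1+L0)
      ... | d , x+d+1≡L0 =
        mixed-gaps⇒⊥ x d (1 + x) x+d+1≡L0 arc₁ sep₁ sep₃ sep₁
          (trans (cong ℓ (trans (detour-end₁ x d) (cong (2 +_) x+d+1≡L0))) sep₂) inside
        where
        inside : ∀ t → 0 < t → t < 2 + d → ℓ (1 + x + t) ≢ fzero
        inside (suc t) _ t<2+d = arc₂ (1 + x + suc t)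
          (≤-trans (s≤s (s≤s (m≤m+n x t))) (≤-reflexive (sym (+-suc (1 + x) t))))
          (≤-trans (≤-reflexive (+-suc (1 + x) t))
                   (s≤s (≤-trans (s≤s (+-monoʳ-≤ x (≤-pred (≤-pred t<2+d)))) (≤-reflexive x+d+1≡L0))))

      -- Both gaps single nodes L0+3 and x+1: these two separators, which
      -- are non-adjacent, each see both arcs.  This is (B2).
      gaps-1-1⇒B2 : ∀ x → x ≤ L0 → ℓ 0 ≡ ℓ x → ℓ (2 + x) ≡ ℓ (2 + L0) → ℓ 0 ≢ ℓ (2 + L0) →
                    ℓ 0 ≢ fzero → ℓ (2 + L0) ≢ fzero → ℓ (1 + x) ≡ fzero → ℓ (3 + L0) ≡ fzero → B2ByLabels
      gaps-1-1⇒B2 x x≤L0 arc₁-const arc₂-const differ 0≢0 X≢0 sep₁ sep₂ =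
        g (3 + L0) , g (1 + x) , g 0 , g (2 + L0) , g x , g (2 + x) ,
        separator⇒∈S (3 + L0) sep₂ , separator⇒∈S (1 + x) sep₁ ,
        distinct-below ≤-refl 1+x<L (λ e → <⇒≢ (s≤s (s≤s (≤-trans x≤L0 (n≤1+n L0)))) (sym e)) ,
        (λ e → non-edge (s≤s (≤-trans (≤-reflexive (+-comm x 2)) (s≤s (s≤s x≤L0)))) ≤-refl (inj₁ (s≤s z≤n)) (E-sym e)) ,
        wrap-edge , E-sym (g-step (2 + L0)) , E-sym (g-step x) , g-step (1 + x) ,
        arc₁-const , sym arc₂-const , differ , 0≢0 , X≢0
        where
        1+x<L : 1 + x < L
        1+x<L = s≤s (s≤s (≤-trans x≤L0 (≤-trans (n≤1+n _) (n≤1+n _))))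

      -- C read from position 0: the arcs 0 … x and y … X contain no
      -- separator and lie in different components, while the inner gap
      -- x+1 … y-1 and the outer gap X+1 … L-1 consist of separators.
      -- Unless both gaps are single nodes (which gives (B2)), s is major,
      -- s ∈ N²²(C), or a shorter even hole exists.
      arcs⇒B2 : ∀ x y X → suc x < y → y ≤ X → suc X < L →
                (∀ t → t ≤ x → ℓ t ≢ fzero) → (∀ t → y ≤ t → t ≤ X → ℓ t ≢ fzero) →
                (∀ t → x < t → t < y → ℓ t ≡ fzero) → (∀ t → X < t → t < L → ℓ t ≡ fzero) →
                ℓ 0 ≢ ℓ X → B2ByLabels
      arcs⇒B2 x y X x+1<y y≤X X+1<L arc₁ arc₂ inner outer differ
        with gap-from-top (≤-pred (≤-pred X+1<L)) | gap-from-bottom x+1<y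
      ... | inj₂ (inj₂ X≤L0) | _ = ⊥-elim (s-not-major (three-separators⇒major (1 + x) (1 + L0) (3 + L0)
              (s≤s (≤-trans x+1<y (≤-trans y≤X X≤L0))) ≤-refl ≤-refl (inj₁ (s≤s z≤n))
              (inner (1 + x) ≤-refl x+1<y) (outer (1 + L0) (s≤s X≤L0) (s≤s (s≤s (m≤n+m L0 2))))
              (outer (3 + L0) (s≤s (≤-pred (≤-pred X+1<L))) ≤-refl)))
      ... | _ | inj₂ (inj₂ x+4≤y) = ⊥-elim (s-not-major (three-separators⇒major (1 + x) (3 + x) (3 + L0)
              ≤-refl (s≤s (s≤s (s≤s (≤-pred (≤-pred (≤-trans x+4≤y (≤-trans y≤X (≤-pred (≤-pred X+1<L))))))))) ≤-refl
              (inj₁ (s≤s z≤n)) (inner (1 + x) ≤-refl x+1<y) (inner (3 + x) (≤-trans (n≤1+n _) (n≤1+n _)) x+4≤y)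
              (outer (3 + L0) (s≤s (≤-pred (≤-pred X+1<L))) ≤-refl)))
      ... | inj₁ refl | inj₁ refl =
        gaps-1-1⇒B2 x (≤-pred (≤-pred y≤X)) (constant-on 0 x z≤n (λ t _ t≤x → arc₁ t t≤x))
          (constant-on y X y≤X arc₂) differ (arc₁ 0 z≤n) (arc₂ X y≤X ≤-refl)
          (inner (1 + x) ≤-refl x+1<y) (outer (3 + L0) ≤-refl ≤-refl)
      ... | inj₁ refl | inj₂ (inj₁ refl) =
        ⊥-elim (gaps-1-2⇒⊥ x y≤X arc₁ arc₂ (inner (1 + x) ≤-refl x+1<y) (inner (2 + x) (n≤1+n _) ≤-refl)
                  (outer (3 + L0) ≤-refl ≤-refl))
      ... | inj₂ (inj₁ refl) | inj₁ refl =
        ⊥-elim (gaps-2-1⇒⊥ x y≤X arc₁ arc₂ (inner (1 + x) ≤-refl x+1<y)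
                  (outer (2 + L0) ≤-refl (s≤s (s≤s (s≤s (n≤1+n _))))) (outer (3 + L0) (s≤s (n≤1+n _)) ≤-refl))
      ... | inj₂ (inj₁ refl) | inj₂ (inj₁ refl) =
        ⊥-elim (proj₂ (clean s) (DoubleGaps.s∈N22 x (≤-pred y≤X) arc₁ arc₂ (inner (1 + x) ≤-refl x+1<y)
                  (inner (2 + x) (n≤1+n _) ≤-refl) (outer (2 + L0) ≤-refl (s≤s (s≤s (s≤s (n≤1+n _)))))
                  (outer (3 + L0) (s≤s (n≤1+n _)) ≤-refl)))

      -- Nonzero, distinct labels at 0 and X, separators after X, and a
      -- label change inside [0, X].  A separator inside either arc
      -- would make s major; otherwise arcs⇒B2 applies.
      two-changes⇒B2 : ∀ X → suc X < L → ℓ 0 ≢ fzero → ℓ X ≢ fzero → ℓ 0 ≢ ℓ X →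
                       (∀ t → X < t → t < L → ℓ t ≡ fzero) → Change X → B2ByLabels
      two-changes⇒B2 X X+1<L 0≢0 X≢0 differ outer
          record { left = x ; right = y ; apart = x+1<y ; right≤ = y≤X ; left≢0 = x≢0 ; right≢0 = y≢0
                 ; between = inner }
        with separator? 0 x | separator? y X
      ... | inj₁ (z , _ , z≤x , z≡0) | _ = ⊥-elim (s-not-major (three-separators⇒major z (1 + x) (3 + L0)
              (s≤s (≤∧≢⇒< z≤x λ { refl → x≢0 z≡0 }))
              (s≤s (≤-trans x+1<y (≤-trans y≤X (≤-pred (≤-pred X+1<L))))) ≤-refl
              (inj₁ (n≢0⇒n>0 λ { refl → 0≢0 z≡0 })) z≡0 (inner (1 + x) ≤-refl x+1<y)
              (outer (3 + L0) (s≤s (≤-pred (≤-pred X+1<L))) ≤-refl)))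
      ... | inj₂ _ | inj₁ (z , y≤z , z≤X , z≡0) = ⊥-elim (s-not-major (three-separators⇒major (1 + x) z (3 + L0)
              (≤-trans (s≤s x+1<y) (≤∧≢⇒< y≤z λ { refl → y≢0 z≡0 }))
              (s≤s (≤-trans (≤∧≢⇒< z≤X λ { refl → X≢0 z≡0 }) (≤-pred (≤-pred X+1<L)))) ≤-refl
              (inj₁ (s≤s z≤n)) (inner (1 + x) ≤-refl x+1<y) z≡0 (outer (3 + L0) (s≤s (≤-pred (≤-pred X+1<L))) ≤-refl)))
      ... | inj₂ arc₁ | inj₂ arc₂ = arcs⇒B2 x y X x+1<y y≤X X+1<L (λ t t≤x → arc₁ t z≤n t≤x) arc₂ inner outer differ

    -- Rotating by y moves the separators
    -- x+1 … y-1 to the end of the period and the nodes y and x to the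
    -- positions 0 and X = x + (L - y); the arc between them contains a
    -- second label change.
    change⇒B2 : (K : Enumeration C) → ∀ {j} → j < At.L K → At.Change K j → B2ByLabels
    change⇒B2 K j<L record { left = x ; right = y ; apart = x+1<y ; right≤ = y≤j ; left≢0 = x≢0
                           ; right≢0 = y≢0 ; distinct = x≢y ; between = inner }
      with m≤n⇒∃[o]m+o≡n (<⇒≤ (≤-<-trans y≤j j<L))
    ... | w , y+w≡L = A₂.two-changes⇒B2 X X+1<L 0≢0 X≢0 0≢X outer (A₂.label-change X 0≢0 X≢0 0≢X)
      where
      module A = At K
      module A₂ = At (rotate K y)
      X : ℕ
      X = x + w
      X+1<L : suc X < A.L
      X+1<L = ≤-trans (+-monoˡ-≤ w x+1<y) (≤-reflexive y+w≡L)
      position-0 : A₂.ℓ 0 ≡ A.ℓ y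
      position-0 = cong A.ℓ (+-identityʳ y)
      position-X : A₂.ℓ X ≡ A.ℓ x
      position-X = trans (cong A.ℓ (trans (regroup y x w) (cong (_+ x) y+w≡L))) (A.ℓ-periodic x)
      0≢0 : A₂.ℓ 0 ≢ fzero
      0≢0 e = y≢0 (trans (sym position-0) e)
      X≢0 : A₂.ℓ X ≢ fzero
      X≢0 e = x≢0 (trans (sym position-X) e)
      0≢X : A₂.ℓ 0 ≢ A₂.ℓ X
      0≢X e = x≢y (sym (trans (sym position-0) (trans e position-X)))
      outer : ∀ t → X < t → t < A.L → A₂.ℓ t ≡ fzero
      outer t X<t t<L with m≤n⇒∃[o]m+o≡n X<t
      ... | u , refl = trans (cong A.ℓ (trans (regroup-suc y x w u) (cong (_+ (suc x + u)) y+w≡L)))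
                             (trans (A.ℓ-periodic (suc x + u)) (inner (suc x + u) (s≤s (m≤m+n x u)) before-y))
        where
        before-y : suc x + u < y
        before-y = +-cancelʳ-≤ w _ _ (≤-trans (≤-reflexive (sym (shift-suc x w u))) (≤-trans t<L (≤-reflexive (sym y+w≡L))))

    module A₀ = At (enumerate C)

    all-in-S⇒covered : (b₀ : Fin n) → H∖S b₀ → ¬ (∃ λ t → t < A₀.L × A₀.ℓ t ≢ fzero) → Covered C
    all-in-S⇒covered b₀ b₀∈ none = b₀ , b₀∈ , λ v v∈C → inj₂ (in-S v v∈C)
      where
      in-S : ∀ v → V G C v → v ∈ S
      in-S v v∈C with A₀.onto-below v v∈C
      ... | t , t<L , gt≡v =
        subst (_∈ S) gt≡v (A₀.separator⇒∈S t (decidable-stable (A₀.ℓ t ≟F fzero) λ t≢0 → none (t , t<L , t≢0)))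

    module FromOutside (t₀ : ℕ) (t₀≢0 : A₀.ℓ t₀ ≢ fzero) where
      K₁ : Enumeration C
      K₁ = rotate (enumerate C) t₀
      module A₁ = At K₁

      start≢0 : A₁.ℓ 0 ≢ fzero
      start≢0 e = t₀≢0 (trans (cong A₀.ℓ (sym (+-identityʳ t₀))) e)

      one-label⇒covered : ¬ (∃ λ j → j < A₁.L × A₁.ℓ j ≢ fzero × A₁.ℓ j ≢ A₁.ℓ 0) → Covered C
      one-label⇒covered none = A₁.g 0 , label≢0⇒H∖S (A₁.g 0) start≢0 , one-component
        where
        one-component : ∀ v → V G C v → Walk G H∖S (A₁.g 0) v ⊎ v ∈ S
        one-component v v∈C with A₁.onto-below v v∈C
        ... | t , t<L , gt≡v with A₁.ℓ t ≟F fzero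
        ...   | yes t≡0 = inj₂ (subst (_∈ S) gt≡v (A₁.separator⇒∈S t t≡0))
        ...   | no t≢0 with A₁.ℓ t ≟F A₁.ℓ 0
        ...     | yes same = inj₁ (subst (Walk G H∖S (A₁.g 0)) gt≡v (same-label⇒walk (sym same) start≢0))
        ...     | no differ = ⊥-elim (none (t , t<L , t≢0 , differ))

      covered-or-B2 : Covered C ⊎ B2ByLabels
      covered-or-B2 with anyUpTo? (λ j → ¬? (A₁.ℓ j ≟F fzero) ×-dec ¬? (A₁.ℓ j ≟F A₁.ℓ 0)) A₁.L
      ... | yes (j , j<L , j≢0 , j≢start) =
            inj₂ (change⇒B2 K₁ j<L (A₁.label-change j start≢0 j≢0 (λ e → j≢start (sym e))))
      ... | no none = inj₁ (one-label⇒covered none)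

    covered-or-B2 : (b₀ : Fin n) → H∖S b₀ → Covered C ⊎ B2ByLabels
    covered-or-B2 b₀ b₀∈ with anyUpTo? (λ t → ¬? (A₀.ℓ t ≟F fzero)) A₀.L
    ... | yes (t₀ , _ , t₀≢0) = FromOutside.covered-or-B2 t₀ t₀≢0
    ... | no none = inj₁ (all-in-S⇒covered b₀ b₀∈ none)

  -- (B2ByLabels) quantifies over nodes only, so it is decidable.
  B2ByLabels? : Dec B2ByLabels
  B2ByLabels? = any? λ s₁ → any? λ s₂ → any? λ x₁ → any? λ x₂ → any? λ y₁ → any? λ y₂ →
    (s₁ ∈? S) ×-dec (s₂ ∈? S) ×-dec ¬? (s₁ ≟F s₂) ×-dec ¬? (E? s₁ s₂) ×-dec
    E? s₁ x₁ ×-dec E? s₁ x₂ ×-dec E? s₂ y₁ ×-dec E? s₂ y₂ ×-dec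
    (label x₁ ≟F label y₁) ×-dec (label x₂ ≟F label y₂) ×-dec ¬? (label x₁ ≟F label x₂) ×-dec
    ¬? (label x₁ ≟F fzero) ×-dec ¬? (label x₂ ≟F fzero)
    where
    E? : ∀ u v → Dec (E G u v)
    E? u v = adj G u v ≟B true

  -- Equal nonzero labels mean a walk in H ∖ S, distinct ones mean none.
  B2ByLabels⇒B2 : B2ByLabels → B2 G H S
  B2ByLabels⇒B2 (s₁ , s₂ , x₁ , x₂ , y₁ , y₂ , s₁∈S , s₂∈S , s₁≢s₂ , s₁≁s₂ , s₁~x₁ , s₁~x₂ , s₂~y₁ , s₂~y₂ ,
                 x₁≈y₁ , x₂≈y₂ , x₁≉x₂ , x₁≢0 , x₂≢0) =
    s₁ , s₂ , s₁∈S , s₂∈S , s₁≢s₂ , s₁≁s₂ , x₁ , x₂ , label≢0⇒H∖S x₁ x₁≢0 , label≢0⇒H∖S x₂ x₂≢0 ,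
    (λ w → x₁≉x₂ (walk⇒same-label w)) ,
    (x₁ , here (label≢0⇒H∖S x₁ x₁≢0) , s₁~x₁) , (x₂ , here (label≢0⇒H∖S x₂ x₂≢0) , s₁~x₂) ,
    (y₁ , same-label⇒walk x₁≈y₁ x₁≢0 , s₂~y₁) , (y₂ , same-label⇒walk x₂≈y₂ x₂≢0 , s₂~y₂)

  hole-covered-or-B2 : (b₀ : Fin n) → H∖S b₀ → (C : Hole G H) → Clean G H C → ShortestEvenHole G H C →
                       Covered C ⊎ B2ByLabels
  hole-covered-or-B2 b₀ b₀∈ C clean shortest with any? (λ i → node C i ≟F s)
  ... | yes s∈C = inj₁ (OnHole.covered C s∈C)
  ... | no s∉C = Analysis.covered-or-B2 {C} s∉C clean shortest b₀ b₀∈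

  B1-or-B2 : (b₀ : Fin n) → H∖S b₀ → ∀ u₁ u₂ u₃ → B1 G H S u₁ u₂ u₃ ⊎ B2 G H S
  B1-or-B2 b₀ b₀∈ u₁ u₂ u₃ with B2ByLabels?
  ... | yes b2 = inj₂ (B2ByLabels⇒B2 b2)
  ... | no ¬b2 = inj₁ λ C (clean , shortest , _) → covered {C} (hole-covered-or-B2 b₀ b₀∈ C clean shortest)
    where
    covered : ∀ {C} → Covered C ⊎ B2ByLabels → Covered C
    covered (inj₁ c) = c
    covered (inj₂ b2) = ⊥-elim (¬b2 b2)

-- Lemma 14.  The star cutset supplies representatives of the components
-- of H ∖ S (at least one, since H ∖ S has more components than H) and the
-- centre s with S = N_H[s].
lemma14 : ∀ {n : ℕ} (G : Graph n) (H S : Subset n) (u₁ u₂ u₃ : Fin n) →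
          Lucky G H u₁ u₂ u₃ → FullStarCutset G H S →
          B1 G H S u₁ u₂ u₃ ⊎ B2 G H S
lemma14 G H S u₁ u₂ u₃ _ ((_ , _ , (_ , suc k , _ , (rep , rep∈ , rep-unique , rep-covers) , _)) ,
                          (s , s∈S , S⊆N[s] , N[s]⊆S)) =
  FullStar.B1-or-B2 G H S s s∈S S⊆N[s] N[s]⊆S rep rep-unique rep-covers (rep fzero) (rep∈ fzero) u₁ u₂ u₃
lemma14 G H S u₁ u₂ u₃ _ ((_ , _ , (_ , zero , _ , _ , ())) , _)
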